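{- Let $G$ be a connected graph with at least two vertices and let $x$ be a vertex of $Y(G)$. Then $x$ lies in a gadget $Y(u)$ for some $u\in V(G)$ with $\deg(u)\ge3$ if and only if $x$ lies on a cycle of length at most $8$ in $Y(G)$; and in this case $V(Y(u))=\{y\in V(Y(G)) : x \text{ and } y \text{ lie on a common cycle of length at most } 8\}$. The same statements hold with $\tilde Y(G)$ in place of $Y(G)$.
   Context: For each vertex $u$ of $G$ let $A(u)=\{a(u,v): uv\in E(G)\}$ and $B(u)=\{b(u,v): uv\in E(G)\}$ be sets of new pairwise distinct elements, and let $M(u)$ be the set of all subsets of $A(u)$ of even cardinality, each regarded as a new vertex. The gadget $Y(u)$ has vertex set $V(Y(u))=A(u)\cup B(u)\cup M(u)$ and, for $m\in M(u)$, the edge $\{a(u,v),m\}$ if $a(u,v)\in m$ and the edge $\{b(u,v),m\}$ if $a(u,v)\notin m$. $Y(G)$ is the disjoint union of all gadgets together with, for each edge $uv\in E(G)$, the edges $\{a(u,v),a(v,u)\}$ and $\{b(u,v),b(v,u)\}$. $\tilde Y(G)$ has the same vertex set and gadgets and is obtained by choosing one edge $u_0v_0$ of $G$ and replacing $\{a(u_0,v_0),a(v_0,u_0)\}$, $\{b(u_0,v_0),b(v_0,u_0)\}$ by $\{a(u_0,v_0),b(v_0,u_0)\}$, $\{b(u_0,v_0),a(v_0,u_0)\}$. -}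

module Defs where

open import Data.Bool using (Bool; true; false; T)
open import Data.Nat using (ℕ; zero; suc; _≤_)
open import Data.Nat.Divisibility using (_∣_)
open import Data.Fin using (Fin; zero; suc; fromℕ; inject₁)
open import Data.Fin.Subset using (Subset; _∈_; _∉_; _⊆_; ∣_∣)
open import Data.Vec using (tabulate)
open import Data.Maybe using (Maybe; just; nothing)
open import Data.Product using (Σ; _×_; _,_; ∃)
open import Data.Sum using (_⊎_)
open import Data.Empty using (⊥)
open import Relation.Nullary using (¬_)
open import Relation.Binary.PropositionalEquality using (_≡_)
open import Function.Definitions using (Injective)
open import Function.Bundles using (_⇔_)

record Graph : Set where
  field
    n      : ℕ
    adj    : Fin n → Fin n → Bool
    sym    : ∀ u v → adj u v ≡ adj v u
    irrefl : ∀ u → adj u u ≡ false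
open Graph public

module _ (G : Graph) where
  N : Fin (n G) → Subset (n G)
  N u = tabulate (adj G u)

  deg : Fin (n G) → ℕ
  deg u = ∣ N u ∣

  data Reach : Fin (n G) → Fin (n G) → Set where
    here : ∀ {u} → Reach u u
    step : ∀ {u v w} → T (adj G u v) → Reach v w → Reach u w

  Connected : Set
  Connected = ∀ u v → Reach u v

  -- Vertices of Y(G): a(u,v), b(u,v) for uv ∈ E(G), and m ∈ M(u),
  -- i.e. an even subset S of A(u) (identified with a subset of N(u)).
  data YV : Set where
    aV : (u v : Fin (n G)) → .(T (adj G u v)) → YV
    bV : (u v : Fin (n G)) → .(T (adj G u v)) → YV
    mV : (u : Fin (n G)) (S : Subset (n G)) → .(S ⊆ N u) → .(2 ∣ ∣ S ∣) → YV

  gadget : YV → Fin (n G)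
  gadget (aV u _ _)   = u
  gadget (bV u _ _)   = u
  gadget (mV u _ _ _) = u

  -- A twist choice: nothing gives Y(G); just (u0,v0,e) gives Ỹ(G) twisted at u0v0.
  TwistChoice : Set
  TwistChoice = Maybe (Σ (Fin (n G)) λ u0 → Σ (Fin (n G)) λ v0 → T (adj G u0 v0))

  Tw : TwistChoice → Fin (n G) → Fin (n G) → Set
  Tw nothing u v = ⊥
  Tw (just (u0 , v0 , _)) u v = (u ≡ u0 × v ≡ v0) ⊎ (u ≡ v0 × v ≡ u0)

  data YE (tw : TwistChoice) : YV → YV → Set where
    am : ∀ {u v S} .{p : T (adj G u v)} .{q : S ⊆ N u} .{r : 2 ∣ ∣ S ∣} → v ∈ S → YE tw (aV u v p) (mV u S q r)
    ma : ∀ {u v S} .{p : T (adj G u v)} .{q : S ⊆ N u} .{r : 2 ∣ ∣ S ∣} → v ∈ S → YE tw (mV u S q r) (aV u v p)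
    bm : ∀ {u v S} .{p : T (adj G u v)} .{q : S ⊆ N u} .{r : 2 ∣ ∣ S ∣} → v ∉ S → YE tw (bV u v p) (mV u S q r)
    mb : ∀ {u v S} .{p : T (adj G u v)} .{q : S ⊆ N u} .{r : 2 ∣ ∣ S ∣} → v ∉ S → YE tw (mV u S q r) (bV u v p)
    aa : ∀ {u v} .{p : T (adj G u v)} .{q : T (adj G v u)} → ¬ Tw tw u v → YE tw (aV u v p) (aV v u q)
    bb : ∀ {u v} .{p : T (adj G u v)} .{q : T (adj G v u)} → ¬ Tw tw u v → YE tw (bV u v p) (bV v u q)
    ab : ∀ {u v} .{p : T (adj G u v)} .{q : T (adj G v u)} → Tw tw u v → YE tw (aV u v p) (bV v u q)
    ba : ∀ {u v} .{p : T (adj G u v)} .{q : T (adj G v u)} → Tw tw u v → YE tw (bV u v p) (aV v u q)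

  record Cycle (tw : TwistChoice) : Set where
    field
      m      : ℕ
      len≥3  : 2 ≤ m
      c      : Fin (suc m) → YV
      inj    : Injective _≡_ _≡_ c
      edges  : ∀ (i : Fin m) → YE tw (c (inject₁ i)) (c (suc i))
      close  : YE tw (c (fromℕ m)) (c zero)

  length : ∀ {tw} → Cycle tw → ℕ
  length C = suc (Cycle.m C)

  OnCycle : ∀ {tw} → YV → Cycle tw → Set
  OnCycle x C = ∃ λ i → Cycle.c C i ≡ x

  OnShortCycle : TwistChoice → YV → Set
  OnShortCycle tw x = Σ (Cycle tw) λ C → length C ≤ 8 × OnCycle x C

  CommonShortCycle : TwistChoice → YV → YV → Set
  CommonShortCycle tw x y =
    Σ (Cycle tw) λ C → length C ≤ 8 × OnCycle x C × OnCycle y C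

module Submission where

-- Inside a gadget Y(u) the vertices of M(u) alternate with the ports a(u,v), b(u,v), and a port is
-- adjacent to m ∈ M(u) exactly when its side (a or b) agrees with the membership of v in m. If
-- deg u ≥ 3, toggling even subsets of N(u) at two neighbours gives alternating 6- and 8-cycles through
-- any two vertices of Y(u). Conversely, M-vertices are pairwise non-adjacent and a port has a single
-- neighbour outside its gadget, so a cycle leaving a gadget crosses at least twice and spends at least
-- three vertices (port, M-vertex, port) in every gadget it visits. With at most 8 vertices there are
-- exactly two crossings and some visit has exactly three vertices; its two ports are then a(w,v) and
-- b(w,v) with a common neighbour, which do not exist. So a short cycle lies in a single Y(u), and
-- deg u ≥ 3 because for deg u ≤ 2 every port of Y(u) has only one neighbour in M(u).

open import Data.Bool using (Bool; true; false; not; T) renaming (_≟_ to _≟ᵇ_)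
open import Data.Bool.Properties using (not-¬; ¬-not; T-≡)
open import Data.Empty using (⊥-elim) renaming (⊥ to ⊥ₑ)
open import Data.Maybe using (just)
open import Data.Sum using (_⊎_; inj₁; inj₂)
open import Data.Fin using (Fin; zero; suc; inject₁; fromℕ; toℕ; fromℕ<; #_) renaming (_≟_ to _≟ᶠ_)
open import Data.Fin.Properties using (¬∀⟶∃¬; toℕ-injective; toℕ<n; toℕ-fromℕ; toℕ-fromℕ<; toℕ-inject₁)
open import Data.Fin.Relation.Unary.Top using (view; ‵fromℕ; ‵inject₁)
open import Data.Fin.Subset using (Subset; outside; _∈_; _∉_; _⊆_; ∣_∣; ⊥)
open import Data.Fin.Subset.Properties
  using (_∈?_; _⊆?_; ∉⊥; nonempty?; Empty-unique; ⊆-antisym; p⊂q⇒∣p∣<∣q∣; ⊥⊆; ∣⊥∣≡0)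
open import Data.Nat
  using (ℕ; zero; suc; _+_; _*_; _∸_; _%_; _/_; NonZero; _≤_; _<_; _≤?_; _<?_; _≟_; z≤n; s≤s; z<s; parity)
open import Data.Nat.DivMod
  using (m≡m%n+[m/n]*n; [m+kn]%n≡m%n; [m+n]%n≡m%n; %-distribˡ-+; m%n<n; m<n⇒m%n≡m; n%n≡0)
open import Data.Nat.Divisibility using (_∣_; _∣?_; _∣0; divides; ∣-refl; ∣m∣n⇒∣m+n; ∣⇒≤)
open import Data.Nat.Properties
  using ( +-assoc; +-comm; m≤m*n; m+[n∸m]≡n; m≤m+n; n≤1+n; m<n⇒m<1+n; ≤-refl; ≤-reflexive; ≤-trans; <-≤-trans
        ; ≤-pred; ≰⇒>; <⇒≱; <⇒≢)
open import Data.Parity.Base using (0ℙ; _⁻¹)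
open import Data.Parity.Properties using (suc-homo-⁻¹; ⁻¹-selfInverse; ⁻¹-involutive; p≢p⁻¹)
open import Data.Product using (_×_; _,_; ∃; ∃₂; proj₁; proj₂)
open import Data.Vec using (Vec; []; _∷_; lookup; map; _[_]%=_; _[_]≔_)
open import Data.Vec.Relation.Unary.All as All using (All; []; _∷_)
open import Data.Vec.Relation.Unary.Linked using (Linked; _∷_; [-])
open import Data.Vec.Relation.Unary.AllPairs using ([]; _∷_)
open import Data.Vec.Relation.Unary.Unique.Propositional using (Unique)
open import Data.Vec.Relation.Unary.Unique.Propositional.Properties using (lookup-injective)
open import Data.Vec.Properties
  using ( ≡-dec; lookup∘tabulate; lookup-replicate; lookup∘updateAt; lookup∘updateAt′; lookup∘update; lookup∘update′
        ; []=⇒lookup; lookup⇒[]=; tabulate∘lookup; tabulate-cong)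
open import Function.Base using (_∘_; case_of_)
open import Function.Bundles using (_⇔_; mk⇔; Equivalence)
open import Relation.Binary.PropositionalEquality
open import Relation.Nullary using (¬_; Dec; yes; no; contradiction; recompute)
open import Relation.Nullary.Decidable using (T?; True; False; toWitness; toWitnessFalse)

open import Defs hiding (sym)

private variable k : ℕ

true≢false : true ≢ false
true≢false ()

not-≢ : ∀ {x y z : Bool} → x ≡ not z → y ≡ z → x ≢ y
not-≢ refl refl eq = not-¬ refl (sym eq)

_≟ˢ_ : (p q : Subset k) → Dec (p ≡ q)
_≟ˢ_ = ≡-dec _≟ᵇ_

toggle : Fin k → Subset k → Subset k
toggle i p = p [ i ]%= not

lookup-toggle-≡ : ∀ i (p : Subset k) → lookup (toggle i p) i ≡ not (lookup p i)
lookup-toggle-≡ i p = lookup∘updateAt i p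

lookup-toggle-≢ : ∀ {i j} (p : Subset k) → j ≢ i → lookup (toggle i p) j ≡ lookup p j
lookup-toggle-≢ {i = i} {j} p j≢i = lookup∘updateAt′ j i j≢i p

parity-suc : ∀ m → parity (suc m) ≡ parity m ⁻¹
parity-suc m = sym (⁻¹-selfInverse (suc-homo-⁻¹ m))

parity-∣toggle∣ : ∀ i (p : Subset k) → parity ∣ toggle i p ∣ ≡ parity ∣ p ∣ ⁻¹
parity-∣toggle∣ zero    (true ∷ p)  = sym (suc-homo-⁻¹ ∣ p ∣)
parity-∣toggle∣ zero    (false ∷ p) = parity-suc ∣ p ∣
parity-∣toggle∣ (suc i) (true ∷ p)  =
  trans (parity-suc ∣ toggle i p ∣) (cong _⁻¹ (trans (parity-∣toggle∣ i p) (sym (parity-suc ∣ p ∣))))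
parity-∣toggle∣ (suc i) (false ∷ p) = parity-∣toggle∣ i p

even⇒parity≡0ℙ : ∀ {m} → 2 ∣ m → parity m ≡ 0ℙ
even⇒parity≡0ℙ (divides q refl) = parity-double q
  where
  parity-double : ∀ q → parity (q * 2) ≡ 0ℙ
  parity-double zero    = refl
  parity-double (suc q) = parity-double q

parity≡0ℙ⇒even : ∀ m → parity m ≡ 0ℙ → 2 ∣ m
parity≡0ℙ⇒even zero          _ = divides 0 refl
parity≡0ℙ⇒even (suc (suc m)) e = ∣m∣n⇒∣m+n ∣-refl (parity≡0ℙ⇒even m e)

toggle₂ : Fin k → Fin k → Subset k → Subset k
toggle₂ i j p = toggle j (toggle i p)

lookup-toggle₂-fst : ∀ {i j} (p : Subset k) → i ≢ j → lookup (toggle₂ i j p) i ≡ not (lookup p i)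
lookup-toggle₂-fst {i = i} p i≢j = trans (lookup-toggle-≢ (toggle i p) i≢j) (lookup-toggle-≡ i p)

lookup-toggle₂-snd : ∀ {i j} (p : Subset k) → i ≢ j → lookup (toggle₂ i j p) j ≡ not (lookup p j)
lookup-toggle₂-snd {i = i} {j} p i≢j =
  trans (lookup-toggle-≡ j (toggle i p)) (cong not (lookup-toggle-≢ p (≢-sym i≢j)))

lookup-toggle₂-other : ∀ {i j l} (p : Subset k) → l ≢ i → l ≢ j → lookup (toggle₂ i j p) l ≡ lookup p l
lookup-toggle₂-other {i = i} p l≢i l≢j = trans (lookup-toggle-≢ (toggle i p) l≢j) (lookup-toggle-≢ p l≢i)

even-toggle₂ : ∀ i j (p : Subset k) → 2 ∣ ∣ p ∣ → 2 ∣ ∣ toggle₂ i j p ∣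
even-toggle₂ i j p even = parity≡0ℙ⇒even _ (begin
  parity ∣ toggle j (toggle i p) ∣  ≡⟨ parity-∣toggle∣ j (toggle i p) ⟩
  parity ∣ toggle i p ∣ ⁻¹          ≡⟨ cong _⁻¹ (parity-∣toggle∣ i p) ⟩
  parity ∣ p ∣ ⁻¹ ⁻¹                ≡⟨ ⁻¹-involutive (parity ∣ p ∣) ⟩
  parity ∣ p ∣                      ≡⟨ even⇒parity≡0ℙ even ⟩
  0ℙ                                ∎)
  where open ≡-Reasoning

toggle₂-⊆ : ∀ {i j} {p q : Subset k} → i ∈ q → j ∈ q → p ⊆ q → toggle₂ i j p ⊆ q
toggle₂-⊆ {i = i} {j} {p} {q} i∈q j∈q p⊆q {l} l∈ with l ≟ᶠ i | l ≟ᶠ j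
... | yes refl | _        = i∈q
... | no _     | yes refl = j∈q
... | no l≢i   | no l≢j   =
  p⊆q (lookup⇒[]= l p (trans (sym (lookup-toggle₂-other p l≢i l≢j)) ([]=⇒lookup l∈)))

lookup-ext : {p q : Subset k} → (∀ i → lookup p i ≡ lookup q i) → p ≡ q
lookup-ext {p = p} {q} eq = trans (sym (tabulate∘lookup p)) (trans (tabulate-cong eq) (tabulate∘lookup q))

∃-difference : {p q : Subset k} → p ≢ q → ∃ λ i → lookup p i ≢ lookup q i
∃-difference {k} {p} {q} p≢q =
  ¬∀⟶∃¬ k _ (λ i → lookup p i ≟ᵇ lookup q i) (λ eq → p≢q (lookup-ext eq))

∃₂-differences : {p q : Subset k} → parity ∣ p ∣ ≡ parity ∣ q ∣ → p ≢ q →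
  ∃₂ λ i j → i ≢ j × lookup q i ≡ not (lookup p i) × lookup q j ≡ not (lookup p j)
∃₂-differences {p = p} {q} same-parity p≢q with ∃-difference p≢q
... | i , pᵢ≢qᵢ with ∃-difference toggled≢q
  where
  toggled≢q : toggle i p ≢ q
  toggled≢q eq = p≢p⁻¹ (parity ∣ q ∣)
    (trans (cong (λ r → parity ∣ r ∣) (sym eq)) (trans (parity-∣toggle∣ i p) (cong _⁻¹ same-parity)))
... | j , differ with j ≟ᶠ i
... | yes refl = contradiction (trans (lookup-toggle-≡ i p) (sym (¬-not (≢-sym pᵢ≢qᵢ)))) differ
... | no j≢i   =
  i , j , ≢-sym j≢i , ¬-not (≢-sym pᵢ≢qᵢ) , ¬-not (≢-sym (subst (_≢ lookup q j) (lookup-toggle-≢ p j≢i) differ))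

∣p∣≤1+∣p[x]≔outside∣ : ∀ (p : Subset k) x → ∣ p ∣ ≤ suc ∣ p [ x ]≔ outside ∣
∣p∣≤1+∣p[x]≔outside∣ (true  ∷ p) zero    = ≤-refl
∣p∣≤1+∣p[x]≔outside∣ (false ∷ p) zero    = n≤1+n ∣ p ∣
∣p∣≤1+∣p[x]≔outside∣ (true  ∷ p) (suc x) = s≤s (∣p∣≤1+∣p[x]≔outside∣ p x)
∣p∣≤1+∣p[x]≔outside∣ (false ∷ p) (suc x) = ∣p∣≤1+∣p[x]≔outside∣ p x

∈-[]≔outside : ∀ {x y} (p : Subset k) → y ∈ p [ x ]≔ outside → y ∈ p × y ≢ x
∈-[]≔outside {x = x} {y} p y∈ =
  lookup⇒[]= y p (trans (sym (lookup∘update′ y≢x p outside)) ([]=⇒lookup y∈)) , y≢x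
  where
  y≢x : y ≢ x
  y≢x refl = contradiction (trans (sym (lookup∘update x p outside)) ([]=⇒lookup y∈)) λ ()

∃-∈-avoiding₂ : {p : Subset k} → 3 ≤ ∣ p ∣ → ∀ i j → ∃ λ l → l ∈ p × l ≢ i × l ≢ j
∃-∈-avoiding₂ {k} {p} 3≤∣p∣ i j with nonempty? (p [ i ]≔ outside [ j ]≔ outside)
... | yes (l , l∈) =
  let l∈′ , l≢j = ∈-[]≔outside (p [ i ]≔ outside) l∈
      l∈p , l≢i = ∈-[]≔outside p l∈′
  in l , l∈p , l≢i , l≢j
... | no empty = contradiction 3≤∣p∣ (<⇒≱ (s≤s (≤-trans (∣p∣≤1+∣p[x]≔outside∣ p i)
                   (s≤s (≤-trans (∣p∣≤1+∣p[x]≔outside∣ (p [ i ]≔ outside) j) (s≤s ∣rest∣≤0))))))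
  where
  ∣rest∣≤0 : ∣ p [ i ]≔ outside [ j ]≔ outside ∣ ≤ 0
  ∣rest∣≤0 = subst (λ q → ∣ q ∣ ≤ 0) (sym (Empty-unique empty)) (≤-reflexive (∣⊥∣≡0 k))

⊆-∣∣-antisym : {p q : Subset k} → p ⊆ q → ∣ q ∣ ≤ ∣ p ∣ → p ≡ q
⊆-∣∣-antisym {p = p} {q} p⊆q ∣q∣≤∣p∣ = ⊆-antisym p⊆q q⊆p
  where
  q⊆p : q ⊆ p
  q⊆p {x} x∈q with x ∈? p
  ... | yes x∈p = x∈p
  ... | no  x∉p = contradiction ∣q∣≤∣p∣ (<⇒≱ (p⊂q⇒∣p∣<∣q∣ (p⊆q , x , x∈q , x∉p)))

even-positive : ∀ {m} → 2 ∣ m → 0 < m → 2 ≤ m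
even-positive {suc m} even _ = ∣⇒≤ even

even-⊆-small-∈ : ∀ {i} {p q : Subset k} → p ⊆ q → ∣ q ∣ ≤ 2 → 2 ∣ ∣ p ∣ → i ∈ p → p ≡ q
even-⊆-small-∈ {k} {i} {p} p⊆q ∣q∣≤2 even i∈p = ⊆-∣∣-antisym p⊆q (≤-trans ∣q∣≤2 (even-positive even 0<∣p∣))
  where
  0<∣p∣ : 0 < ∣ p ∣
  0<∣p∣ = subst (_< ∣ p ∣) (∣⊥∣≡0 k) (p⊂q⇒∣p∣<∣q∣ (⊥⊆ , i , i∈p , ∉⊥))

even-≤1⇒≡0 : ∀ {m} → 2 ∣ m → m ≤ 1 → m ≡ 0
even-≤1⇒≡0 {zero}  _    _     = refl
even-≤1⇒≡0 {suc m} even 1+m≤1 = contradiction (even-positive even (s≤s z≤n)) (<⇒≱ (s≤s 1+m≤1))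

even-⊆-small-∉ : ∀ {i} {p q : Subset k} → p ⊆ q → ∣ q ∣ ≤ 2 → 2 ∣ ∣ p ∣ → i ∈ q → i ∉ p → p ≡ ⊥
even-⊆-small-∉ {k} {i} {p} p⊆q ∣q∣≤2 even i∈q i∉p =
  sym (⊆-∣∣-antisym ⊥⊆ (≤-reflexive (trans (even-≤1⇒≡0 even ∣p∣≤1) (sym (∣⊥∣≡0 k)))))
  where
  ∣p∣≤1 : ∣ p ∣ ≤ 1
  ∣p∣≤1 = ≤-pred (<-≤-trans (p⊂q⇒∣p∣<∣q∣ (p⊆q , i , i∈q , i∉p)) ∣q∣≤2)

module _ (L : ℕ) .{{_ : NonZero L}} where

  suc-% : ∀ a → suc a % L ≡ suc (a % L) % L
  suc-% a = trans (cong (λ t → suc t % L) (m≡m%n+[m/n]*n a L)) ([m+kn]%n≡m%n (suc (a % L)) (a / L) L)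

  +-cancelʳ-% : ∀ a b j → (a + j) % L ≡ (b + j) % L → a % L ≡ b % L
  +-cancelʳ-% a b j eq = trans (shift a) (trans (cong (λ r → (r + t % L) % L) eq) (sym (shift b)))
    where
    t = j * L ∸ j
    shift : ∀ x → x % L ≡ ((x + j) % L + t % L) % L
    shift x = begin
      x % L              ≡⟨ [m+kn]%n≡m%n x j L ⟨
      (x + j * L) % L    ≡⟨ cong (λ r → (x + r) % L) (m+[n∸m]≡n (m≤m*n j L)) ⟨
      (x + (j + t)) % L  ≡⟨ cong (_% L) (+-assoc x j t) ⟨
      (x + j + t) % L    ≡⟨ %-distribˡ-+ (x + j) t L ⟩
      ((x + j) % L + t % L) % L ∎
      where open ≡-Reasoning

module _ {a} {A : Set a} where

  Linked-lookup : ∀ {r} {R : A → A → Set r} {m} {xs : Vec A (suc m)} →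
    Linked R xs → (i : Fin m) → R (lookup xs (inject₁ i)) (lookup xs (suc i))
  Linked-lookup {xs = _ ∷ _ ∷ _} (r ∷ _)  zero    = r
  Linked-lookup                  (_ ∷ rs) (suc i) = Linked-lookup rs i

  interleave : Vec A k → Vec A k → Vec A (k * 2)
  interleave []       []       = []
  interleave (x ∷ xs) (y ∷ ys) = x ∷ y ∷ interleave xs ys

  All-interleave : ∀ {p} {P : A → Set p} {xs ys : Vec A k} → All P xs → All P ys → All P (interleave xs ys)
  All-interleave []         []         = []
  All-interleave (px ∷ pxs) (py ∷ pys) = px ∷ py ∷ All-interleave pxs pys

  Unique-interleave : ∀ {p} {P : A → Set p} {xs ys : Vec A k} →
    All P xs → All (¬_ ∘ P) ys → Unique xs → Unique ys → Unique (interleave xs ys)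
  Unique-interleave []         []           []           []           = []
  Unique-interleave {P = P} (px ∷ pxs) (¬py ∷ ¬pys) (x∉xs ∷ uxs) (y∉ys ∷ uys) =
      (separated px ¬py ∷ All-interleave x∉xs (All.map (separated px) ¬pys))
    ∷ All-interleave (All.map (λ px′ → ≢-sym (separated px′ ¬py)) pxs) y∉ys
    ∷ Unique-interleave pxs ¬pys uxs uys
    where
    separated : ∀ {x y} → P x → ¬ P y → x ≢ y
    separated px ¬py refl = ¬py px

module _ (G : Graph) where

  V : Set
  V = Fin (n G)

  adj⇒∈N : ∀ {u v} → .(T (adj G u v)) → v ∈ N G u
  adj⇒∈N {u} {v} uv = lookup⇒[]= v (N G u)
    (trans (lookup∘tabulate (adj G u) v) (Equivalence.to T-≡ (recompute (T? (adj G u v)) uv)))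

  ∈N⇒adj : ∀ {u v} → v ∈ N G u → T (adj G u v)
  ∈N⇒adj {u} {v} v∈N = Equivalence.from T-≡ (trans (sym (lookup∘tabulate (adj G u) v)) ([]=⇒lookup v∈N))

  record EvenSubset (u : V) : Set where
    field
      set  : Subset (n G)
      ⊆N   : set ⊆ N G u
      even : 2 ∣ ∣ set ∣
  open EvenSubset

  record Port (u : V) : Set where
    constructor port
    field
      to        : V
      side      : Bool
      .adjacent : T (adj G u to)
  open Port

  midV : ∀ {u} → EvenSubset u → YV G
  midV {u} X = mV u (set X) (⊆N X) (even X)

  portV : ∀ {u} → Port u → YV G
  portV {u} (port v true  p) = aV u v p
  portV {u} (port v false p) = bV u v p

  data InGadget (u : V) : YV G → Set where
    port∈ : (ℓ : Port u) → InGadget u (portV ℓ)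
    mid∈  : (X : EvenSubset u) → InGadget u (midV X)

  recompute-⊆ : ∀ {u S} → .(S ⊆ N G u) → S ⊆ N G u
  recompute-⊆ {u} {S} = recompute (S ⊆? N G u)

  recompute-even : ∀ {S : Subset (n G)} → .(2 ∣ ∣ S ∣) → 2 ∣ ∣ S ∣
  recompute-even {S} = recompute (2 ∣? ∣ S ∣)

  inGadget : ∀ {u} x → gadget G x ≡ u → InGadget u x
  inGadget (aV u v p)   refl = port∈ (port v true p)
  inGadget (bV u v p)   refl = port∈ (port v false p)
  inGadget (mV u S q r) refl = mid∈ (record { set = S ; ⊆N = recompute-⊆ q ; even = recompute-even {S} r })

  mV-cong : ∀ {u S S′} .{q : S ⊆ N G u} .{q′ : S′ ⊆ N G u} .{r : 2 ∣ ∣ S ∣} .{r′ : 2 ∣ ∣ S′ ∣} →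
    S ≡ S′ → _≡_ {A = YV G} (mV u S q r) (mV u S′ q′ r′)
  mV-cong refl = refl

  midV-injective : ∀ {u} {X Y : EvenSubset u} → midV X ≡ midV Y → set X ≡ set Y
  midV-injective refl = refl

  portV-injective : ∀ {u} {ℓ ℓ′ : Port u} → portV ℓ ≡ portV ℓ′ → to ℓ ≡ to ℓ′ × side ℓ ≡ side ℓ′
  portV-injective {ℓ = port _ true  _} {port _ true  _} refl = refl , refl
  portV-injective {ℓ = port _ false _} {port _ false _} refl = refl , refl

  midV≢portV : ∀ {u} {X : EvenSubset u} {ℓ : Port u} → midV X ≢ portV ℓ
  midV≢portV {ℓ = port _ true  _} ()
  midV≢portV {ℓ = port _ false _} ()

  module _ {u : V} where

    toggled : EvenSubset u → {i j : V} → i ∈ N G u → j ∈ N G u → EvenSubset u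
    toggled X {i} {j} i∈N j∈N = record
      { set  = toggle₂ i j (set X)
      ; ⊆N   = toggle₂-⊆ i∈N j∈N (⊆N X)
      ; even = even-toggle₂ i j (set X) (even X)
      }

    ∅ : EvenSubset u
    ∅ = record { set = ⊥ ; ⊆N = ⊥⊆ ; even = subst (2 ∣_) (sym (∣⊥∣≡0 (n G))) (2 ∣0) }

    same-parity : (X Y : EvenSubset u) → parity ∣ set X ∣ ≡ parity ∣ set Y ∣
    same-parity X Y = trans (even⇒parity≡0ℙ (even X)) (sym (even⇒parity≡0ℙ (even Y)))

    flipped⇒∈N : ∀ {i} (X Y : EvenSubset u) → lookup (set Y) i ≡ not (lookup (set X) i) → i ∈ N G u
    flipped⇒∈N {i} X Y flipped with lookup (set X) i in Xᵢ
    ... | true  = ⊆N X (lookup⇒[]= i (set X) Xᵢ)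
    ... | false = ⊆N Y (lookup⇒[]= i (set Y) flipped)

    midV-≢-at : ∀ (X Y : EvenSubset u) i → lookup (set X) i ≢ lookup (set Y) i → midV X ≢ midV Y
    midV-≢-at X Y i differ eq = differ (cong (λ S → lookup S i) (midV-injective {X = X} {Y} eq))

    portV-≢-to : ∀ {ℓ ℓ′ : Port u} → to ℓ ≢ to ℓ′ → portV ℓ ≢ portV ℓ′
    portV-≢-to differ eq = differ (proj₁ (portV-injective eq))

    portV-≢-side : ∀ {ℓ ℓ′ : Port u} → side ℓ ≢ side ℓ′ → portV ℓ ≢ portV ℓ′
    portV-≢-side differ eq = differ (proj₂ (portV-injective eq))

    portV-cong : ∀ {v β γ} .{p q : T (adj G u v)} → β ≡ γ → portV (port v β p) ≡ portV (port v γ q)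
    portV-cong refl = refl

    ∃-even-subset-with-sides : ∀ {v w z} → v ∈ N G u → w ∈ N G u → z ∈ N G u → v ≢ w → z ≢ v → z ≢ w →
      ∀ β γ → ∃ λ (X : EvenSubset u) → lookup (set X) v ≡ β × lookup (set X) w ≡ γ
    ∃-even-subset-with-sides {v} {w} _ _ _ _ _ _ false false =
      ∅ , lookup-replicate v false , lookup-replicate w false
    ∃-even-subset-with-sides {v} {w} v∈N w∈N _ v≢w _ _ true true =
      toggled ∅ v∈N w∈N
      , trans (lookup-toggle₂-fst ⊥ v≢w) (cong not (lookup-replicate v false))
      , trans (lookup-toggle₂-snd ⊥ v≢w) (cong not (lookup-replicate w false))
    ∃-even-subset-with-sides {v} {w} v∈N _ z∈N v≢w z≢v z≢w true false =
      toggled ∅ v∈N z∈N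
      , trans (lookup-toggle₂-fst ⊥ (≢-sym z≢v)) (cong not (lookup-replicate v false))
      , trans (lookup-toggle₂-other ⊥ (≢-sym v≢w) (≢-sym z≢w)) (lookup-replicate w false)
    ∃-even-subset-with-sides {v} {w} _ w∈N z∈N v≢w z≢v z≢w false true =
      toggled ∅ w∈N z∈N
      , trans (lookup-toggle₂-other ⊥ v≢w (≢-sym z≢v)) (lookup-replicate v false)
      , trans (lookup-toggle₂-fst ⊥ (≢-sym z≢w)) (cong not (lookup-replicate w false))

    Meets : EvenSubset u → Port u → Set
    Meets X ℓ = lookup (set X) (to ℓ) ≡ side ℓ

  -- Short cycles through the vertices of a gadget

  module _ (tw : TwistChoice G) where

    CommonShortCycle-sym : ∀ {x y} → CommonShortCycle G tw x y → CommonShortCycle G tw y x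
    CommonShortCycle-sym (C , short , on-x , on-y) = C , short , on-y , on-x

    cycle-of-vec : ∀ {m} (xs : Vec (YV G) (3 + m)) → Unique xs → Linked (YE G tw) xs →
      YE G tw (lookup xs (fromℕ (2 + m))) (lookup xs zero) → Cycle G tw
    cycle-of-vec {m} xs unique path closing = record
      { m = 2 + m ; len≥3 = s≤s (s≤s z≤n) ; c = lookup xs ; inj = lookup-injective unique _ _
      ; edges = Linked-lookup path ; close = closing }

    module _ {u : V} where

      port—mid : ∀ (X : EvenSubset u) (ℓ : Port u) → Meets X ℓ → YE G tw (portV ℓ) (midV X)
      port—mid X (port v true  _) meets = am (lookup⇒[]= v (set X) meets)
      port—mid X (port v false _) meets = bm (λ v∈X → not-¬ ([]=⇒lookup v∈X) meets)

      mid—port : ∀ (X : EvenSubset u) (ℓ : Port u) → Meets X ℓ → YE G tw (midV X) (portV ℓ)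
      mid—port X (port v true  _) meets = ma (lookup⇒[]= v (set X) meets)
      mid—port X (port v false _) meets = mb (λ v∈X → not-¬ ([]=⇒lookup v∈X) meets)

      IsMidV : YV G → Set
      IsMidV x = ∃ λ (X : EvenSubset u) → midV X ≡ x

      ports-are-not-mids : ∀ {k} (ℓs : Vec (Port u) k) → All (¬_ ∘ IsMidV) (map portV ℓs)
      ports-are-not-mids []       = []
      ports-are-not-mids (ℓ ∷ ℓs) = (λ (X , eq) → midV≢portV {X = X} {ℓ} eq) ∷ ports-are-not-mids ℓs

      mids-are-mids : ∀ {k} (Xs : Vec (EvenSubset u) k) → All IsMidV (map midV Xs)
      mids-are-mids []       = []
      mids-are-mids (X ∷ Xs) = (X , refl) ∷ mids-are-mids Xs

      hexagon : (X₀ X₁ X₂ : EvenSubset u) (ℓ₀ ℓ₁ ℓ₂ : Port u) →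
        Meets X₀ ℓ₀ → Meets X₁ ℓ₀ → Meets X₁ ℓ₁ → Meets X₂ ℓ₁ → Meets X₂ ℓ₂ → Meets X₀ ℓ₂ →
        Unique (midV X₀ ∷ midV X₁ ∷ midV X₂ ∷ []) → Unique (portV ℓ₀ ∷ portV ℓ₁ ∷ portV ℓ₂ ∷ []) →
        Cycle G tw
      hexagon X₀ X₁ X₂ ℓ₀ ℓ₁ ℓ₂ m₀₀ m₁₀ m₁₁ m₂₁ m₂₂ m₀₂ distinct-mids distinct-ports =
        cycle-of-vec (interleave (map midV Xs) (map portV ℓs))
          (Unique-interleave (mids-are-mids Xs) (ports-are-not-mids ℓs) distinct-mids distinct-ports)
          (mid—port X₀ ℓ₀ m₀₀ ∷ port—mid X₁ ℓ₀ m₁₀ ∷ mid—port X₁ ℓ₁ m₁₁ ∷ port—mid X₂ ℓ₁ m₂₁ ∷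
           mid—port X₂ ℓ₂ m₂₂ ∷ [-])
          (port—mid X₀ ℓ₂ m₀₂)
        where
        Xs = X₀ ∷ X₁ ∷ X₂ ∷ []
        ℓs = ℓ₀ ∷ ℓ₁ ∷ ℓ₂ ∷ []

      octagon : (X₀ X₁ X₂ X₃ : EvenSubset u) (ℓ₀ ℓ₁ ℓ₂ ℓ₃ : Port u) →
        Meets X₀ ℓ₀ → Meets X₁ ℓ₀ → Meets X₁ ℓ₁ → Meets X₂ ℓ₁ →
        Meets X₂ ℓ₂ → Meets X₃ ℓ₂ → Meets X₃ ℓ₃ → Meets X₀ ℓ₃ →
        Unique (midV X₀ ∷ midV X₁ ∷ midV X₂ ∷ midV X₃ ∷ []) →
        Unique (portV ℓ₀ ∷ portV ℓ₁ ∷ portV ℓ₂ ∷ portV ℓ₃ ∷ []) →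
        Cycle G tw
      octagon X₀ X₁ X₂ X₃ ℓ₀ ℓ₁ ℓ₂ ℓ₃ m₀₀ m₁₀ m₁₁ m₂₁ m₂₂ m₃₂ m₃₃ m₀₃ distinct-mids distinct-ports =
        cycle-of-vec (interleave (map midV Xs) (map portV ℓs))
          (Unique-interleave (mids-are-mids Xs) (ports-are-not-mids ℓs) distinct-mids distinct-ports)
          (mid—port X₀ ℓ₀ m₀₀ ∷ port—mid X₁ ℓ₀ m₁₀ ∷ mid—port X₁ ℓ₁ m₁₁ ∷ port—mid X₂ ℓ₁ m₂₁ ∷
           mid—port X₂ ℓ₂ m₂₂ ∷ port—mid X₃ ℓ₂ m₃₂ ∷ mid—port X₃ ℓ₃ m₃₃ ∷ [-])
          (port—mid X₀ ℓ₃ m₀₃)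
        where
        Xs = X₀ ∷ X₁ ∷ X₂ ∷ X₃ ∷ []
        ℓs = ℓ₀ ∷ ℓ₁ ∷ ℓ₂ ∷ ℓ₃ ∷ []

      -- X ─r─ X⊕{p,q} ─q─ X⊕{q,r} ─p─ X
      toggle-hexagon : (X : EvenSubset u) {p q r : V} → p ∈ N G u → q ∈ N G u → r ∈ N G u →
        p ≢ q → p ≢ r → q ≢ r → Cycle G tw
      toggle-hexagon X {p} {q} {r} p∈N q∈N r∈N p≢q p≢r q≢r =
        hexagon X X₁ X₂ ℓ₀ ℓ₁ ℓ₂
          refl (lookup-toggle₂-other S (≢-sym p≢r) (≢-sym q≢r))
          (lookup-toggle₂-snd S p≢q) X₂q
          (lookup-toggle₂-other S p≢q p≢r) refl
          ((midV-≢-at X X₁ p (≢-sym (not-≢ X₁p refl)) ∷ midV-≢-at X X₂ q (≢-sym (not-≢ X₂q refl)) ∷ [])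
           ∷ (midV-≢-at X₁ X₂ p (not-≢ X₁p (lookup-toggle₂-other S p≢q p≢r)) ∷ []) ∷ [] ∷ [])
          ((portV-≢-to (≢-sym q≢r) ∷ portV-≢-to (≢-sym p≢r) ∷ []) ∷ (portV-≢-to (≢-sym p≢q) ∷ []) ∷ [] ∷ [])
        where
        S  = set X
        X₁ = toggled X p∈N q∈N
        X₂ = toggled X q∈N r∈N
        ℓ₀ = port r (lookup S r) (∈N⇒adj r∈N)
        ℓ₁ = port q (not (lookup S q)) (∈N⇒adj q∈N)
        ℓ₂ = port p (lookup S p) (∈N⇒adj p∈N)
        X₁p : lookup (set X₁) p ≡ not (lookup S p)
        X₁p = lookup-toggle₂-fst S p≢q
        X₂q : lookup (set X₂) q ≡ not (lookup S q)
        X₂q = lookup-toggle₂-fst S q≢r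

      -- X ─p─ X⊕{q,r} ─q─ Y ─r─ X⊕{p,r} ─s─ X
      toggle-octagon : (X Y : EvenSubset u) {p q r s : V} →
        p ≢ q → p ≢ r → p ≢ s → q ≢ r → q ≢ s → r ≢ s →
        lookup (set Y) p ≡ not (lookup (set X) p) → lookup (set Y) q ≡ not (lookup (set X) q) →
        lookup (set Y) r ≡ not (lookup (set X) r) → lookup (set Y) s ≡ not (lookup (set X) s) →
        Cycle G tw
      toggle-octagon X Y {p} {q} {r} {s} p≢q p≢r p≢s q≢r q≢s r≢s Yp Yq Yr Ys =
        octagon X X₁ Y X₃ ℓ₀ ℓ₁ ℓ₂ ℓ₃
          refl (lookup-toggle₂-other S p≢q p≢r)
          (trans X₁q (sym Yq)) refl
          refl (trans (lookup-toggle₂-snd S p≢r) (sym Yr))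
          X₃s refl
          ((midV-≢-at X X₁ q (≢-sym (not-≢ X₁q refl)) ∷ midV-≢-at X Y p (≢-sym (not-≢ Yp refl))
             ∷ midV-≢-at X X₃ p (≢-sym (not-≢ (lookup-toggle₂-fst S p≢r) refl)) ∷ [])
           ∷ (midV-≢-at X₁ Y s (≢-sym (not-≢ Ys X₁s)) ∷ midV-≢-at X₁ X₃ q (not-≢ X₁q X₃q) ∷ [])
           ∷ (midV-≢-at Y X₃ s (not-≢ Ys X₃s) ∷ []) ∷ [] ∷ [])
          ((portV-≢-to p≢q ∷ portV-≢-to p≢r ∷ portV-≢-to p≢s ∷ [])
           ∷ (portV-≢-to q≢r ∷ portV-≢-to q≢s ∷ []) ∷ (portV-≢-to r≢s ∷ []) ∷ [] ∷ [])
        where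
        S  = set X
        p∈N = flipped⇒∈N X Y Yp
        q∈N = flipped⇒∈N X Y Yq
        r∈N = flipped⇒∈N X Y Yr
        s∈N = flipped⇒∈N X Y Ys
        X₁ = toggled X q∈N r∈N
        X₃ = toggled X p∈N r∈N
        ℓ₀ = port p (lookup S p) (∈N⇒adj p∈N)
        ℓ₁ = port q (lookup (set Y) q) (∈N⇒adj q∈N)
        ℓ₂ = port r (lookup (set Y) r) (∈N⇒adj r∈N)
        ℓ₃ = port s (lookup S s) (∈N⇒adj s∈N)
        X₁q : lookup (set X₁) q ≡ not (lookup S q)
        X₁q = lookup-toggle₂-fst S q≢r
        X₁s : lookup (set X₁) s ≡ lookup S s
        X₁s = lookup-toggle₂-other S (≢-sym q≢s) (≢-sym r≢s)
        X₃q : lookup (set X₃) q ≡ lookup S q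
        X₃q = lookup-toggle₂-other S (≢-sym p≢q) q≢r
        X₃s : lookup (set X₃) s ≡ lookup S s
        X₃s = lookup-toggle₂-other S (≢-sym p≢s) (≢-sym r≢s)

      -- X ─v─ X⊕{z,w} ─w─ X⊕{v,w} ─v─ X⊕{v,z} ─w─ X, through both ports towards v
      twin-octagon : (X : EvenSubset u) {v z w : V} → v ∈ N G u → z ∈ N G u → w ∈ N G u →
        v ≢ z → v ≢ w → z ≢ w → Cycle G tw
      twin-octagon X {v} {z} {w} v∈N z∈N w∈N v≢z v≢w z≢w =
        octagon X X₁ X₂ X₃ ℓ₀ ℓ₁ ℓ₂ ℓ₃
          refl (lookup-toggle₂-other S v≢z v≢w)
          X₁w X₂w
          (lookup-toggle₂-fst S v≢w) (lookup-toggle₂-fst S v≢z)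
          X₃w refl
          ((midV-≢-at X X₁ z (≢-sym (not-≢ X₁z refl))
             ∷ midV-≢-at X X₂ v (≢-sym (not-≢ (lookup-toggle₂-fst S v≢w) refl))
             ∷ midV-≢-at X X₃ v (≢-sym (not-≢ (lookup-toggle₂-fst S v≢z) refl)) ∷ [])
           ∷ (midV-≢-at X₁ X₂ z (not-≢ X₁z (lookup-toggle₂-other S (≢-sym v≢z) z≢w))
             ∷ midV-≢-at X₁ X₃ w (not-≢ X₁w X₃w) ∷ [])
           ∷ (midV-≢-at X₂ X₃ w (not-≢ X₂w X₃w) ∷ []) ∷ [] ∷ [])
          ((portV-≢-to v≢w ∷ portV-≢-side (not-¬ refl) ∷ portV-≢-to v≢w ∷ [])
           ∷ (portV-≢-to (≢-sym v≢w) ∷ portV-≢-side (≢-sym (not-¬ refl)) ∷ [])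
           ∷ (portV-≢-to v≢w ∷ []) ∷ [] ∷ [])
        where
        S  = set X
        X₁ = toggled X z∈N w∈N
        X₂ = toggled X v∈N w∈N
        X₃ = toggled X v∈N z∈N
        ℓ₀ = port v (lookup S v) (∈N⇒adj v∈N)
        ℓ₁ = port w (not (lookup S w)) (∈N⇒adj w∈N)
        ℓ₂ = port v (not (lookup S v)) (∈N⇒adj v∈N)
        ℓ₃ = port w (lookup S w) (∈N⇒adj w∈N)
        X₁z : lookup (set X₁) z ≡ not (lookup S z)
        X₁z = lookup-toggle₂-fst S z≢w
        X₁w : lookup (set X₁) w ≡ not (lookup S w)
        X₁w = lookup-toggle₂-snd S z≢w
        X₂w : lookup (set X₂) w ≡ not (lookup S w)
        X₂w = lookup-toggle₂-snd S v≢w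
        X₃w : lookup (set X₃) w ≡ lookup S w
        X₃w = lookup-toggle₂-other S (≢-sym v≢w) (≢-sym z≢w)

      module _ (3≤deg : 3 ≤ deg G u) where

        ∃-neighbour-avoiding : ∀ i j → ∃ λ l → l ∈ N G u × l ≢ i × l ≢ j
        ∃-neighbour-avoiding = ∃-∈-avoiding₂ 3≤deg

        hexagon-through : EvenSubset u → Cycle G tw
        hexagon-through X =
          let p , p∈N , _         = ∃-neighbour-avoiding u u
              q , q∈N , q≢p , _   = ∃-neighbour-avoiding p p
              r , r∈N , r≢p , r≢q = ∃-neighbour-avoiding p q
          in toggle-hexagon X p∈N q∈N r∈N (≢-sym q≢p) (≢-sym r≢p) (≢-sym r≢q)

        6≤8 : 6 ≤ 8
        6≤8 = m≤m+n 6 2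

        -- Either X⊕{p,q} = Y, or by parity they differ at two more neighbours, where X and Y differ too.
        flipped-twice-share-short-cycle : (X Y : EvenSubset u) {p q : V} → p ≢ q →
          lookup (set Y) p ≡ not (lookup (set X) p) → lookup (set Y) q ≡ not (lookup (set X) q) →
          CommonShortCycle G tw (midV X) (midV Y)
        flipped-twice-share-short-cycle X Y {p} {q} p≢q Yp Yq = case set X′ ≟ˢ set Y of λ where
            (yes X′≡Y) →
              let r , r∈N , r≢p , r≢q = ∃-neighbour-avoiding p q
              in  toggle-hexagon X p∈N q∈N r∈N p≢q (≢-sym r≢p) (≢-sym r≢q)
                , 6≤8 , (# 0 , refl) , (# 2 , mV-cong X′≡Y)
            (no X′≢Y) →
              let r , s , r≢s , Yr , Ys = ∃₂-differences (same-parity X′ Y) X′≢Y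
                  r≢p , r≢q , Yr = flipped-elsewhere Yr
                  s≢p , s≢q , Ys = flipped-elsewhere Ys
              in  toggle-octagon X Y p≢q (≢-sym r≢p) (≢-sym s≢p) (≢-sym r≢q) (≢-sym s≢q) r≢s Yp Yq Yr Ys
                , ≤-refl , (# 0 , refl) , (# 4 , refl)
          where
          p∈N = flipped⇒∈N X Y Yp
          q∈N = flipped⇒∈N X Y Yq
          X′ = toggled X p∈N q∈N
          flipped-elsewhere : ∀ {i} → lookup (set Y) i ≡ not (lookup (set X′) i) →
            i ≢ p × i ≢ q × lookup (set Y) i ≡ not (lookup (set X) i)
          flipped-elsewhere {i} Yi = i≢p , i≢q , trans Yi (cong not (lookup-toggle₂-other (set X) i≢p i≢q))
            where
            i≢p : i ≢ p
            i≢p refl = not-≢ Yi (trans Yp (sym (lookup-toggle₂-fst (set X) p≢q))) refl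
            i≢q : i ≢ q
            i≢q refl = not-≢ Yi (trans Yq (sym (lookup-toggle₂-snd (set X) p≢q))) refl

        mids-share-short-cycle : (X Y : EvenSubset u) → CommonShortCycle G tw (midV X) (midV Y)
        mids-share-short-cycle X Y = case set X ≟ˢ set Y of λ where
          (yes X≡Y) → hexagon-through X , 6≤8 , (# 0 , refl) , (# 0 , mV-cong X≡Y)
          (no X≢Y)  → let p , q , p≢q , Yp , Yq = ∃₂-differences (same-parity X Y) X≢Y
                      in flipped-twice-share-short-cycle X Y p≢q Yp Yq

        port-and-mid-share-short-cycle : (ℓ : Port u) (X : EvenSubset u) →
          CommonShortCycle G tw (portV ℓ) (midV X)
        port-and-mid-share-short-cycle (port v β uv) X with ∃-neighbour-avoiding v v
        ... | a , a∈N , a≢v , _ with ∃-neighbour-avoiding v a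
        ... | b , b∈N , b≢v , b≢a with lookup (set X) v ≟ᵇ β
        ... | yes Xv≡β = toggle-hexagon X a∈N b∈N (adj⇒∈N uv) (≢-sym b≢a) a≢v b≢v
                       , 6≤8 , (# 1 , portV-cong Xv≡β) , (# 0 , refl)
        ... | no Xv≢β  = toggle-hexagon X a∈N (adj⇒∈N uv) b∈N a≢v (≢-sym b≢a) (≢-sym b≢v)
                       , 6≤8 , (# 3 , portV-cong (sym (¬-not (≢-sym Xv≢β)))) , (# 0 , refl)

        twins-share-short-cycle : ∀ {v} .(p q : T (adj G u v)) →
          CommonShortCycle G tw (portV (port v false p)) (portV (port v true q))
        twins-share-short-cycle {v} p q with ∃-neighbour-avoiding v v
        ... | z , z∈N , z≢v , _ with ∃-neighbour-avoiding v z
        ... | w , w∈N , w≢v , w≢z =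
          twin-octagon ∅ (adj⇒∈N p) z∈N w∈N (≢-sym z≢v) (≢-sym w≢v) (≢-sym w≢z)
          , ≤-refl
          , (# 1 , portV-cong (lookup-replicate v false))
          , (# 5 , portV-cong (cong not (lookup-replicate v false)))

        ports-share-short-cycle : (ℓ ℓ′ : Port u) → CommonShortCycle G tw (portV ℓ) (portV ℓ′)
        ports-share-short-cycle (port v β p) (port w γ q) with v ≟ᶠ w
        ports-share-short-cycle (port v false p) (port v false q) | yes refl =
          let C , short , on-ℓ , _ = port-and-mid-share-short-cycle (port v false p) ∅
          in  C , short , on-ℓ , on-ℓ
        ports-share-short-cycle (port v true p) (port v true q) | yes refl =
          let C , short , on-ℓ , _ = port-and-mid-share-short-cycle (port v true p) ∅
          in  C , short , on-ℓ , on-ℓ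
        ports-share-short-cycle (port v false p) (port v true q) | yes refl = twins-share-short-cycle p q
        ports-share-short-cycle (port v true p) (port v false q) | yes refl =
          CommonShortCycle-sym (twins-share-short-cycle q p)
        ports-share-short-cycle (port v β p) (port w γ q) | no v≢w with ∃-neighbour-avoiding v w
        ... | z , z∈N , z≢v , z≢w with ∃-even-subset-with-sides (adj⇒∈N p) (adj⇒∈N q) z∈N v≢w z≢v z≢w β γ
        ... | X , Xv , Xw =
          toggle-hexagon X (adj⇒∈N q) z∈N (adj⇒∈N p) (≢-sym z≢w) (≢-sym v≢w) z≢v
          , 6≤8 , (# 1 , portV-cong Xv) , (# 5 , portV-cong Xw)

        gadget-vertices-share-short-cycle : ∀ x y → gadget G x ≡ u → gadget G y ≡ u →
          CommonShortCycle G tw x y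
        gadget-vertices-share-short-cycle x y x∈Yu y∈Yu with inGadget x x∈Yu | inGadget y y∈Yu
        ... | port∈ ℓ | port∈ ℓ′ = ports-share-short-cycle ℓ ℓ′
        ... | port∈ ℓ | mid∈ Y   = port-and-mid-share-short-cycle ℓ Y
        ... | mid∈ X  | port∈ ℓ  = CommonShortCycle-sym (port-and-mid-share-short-cycle ℓ X)
        ... | mid∈ X  | mid∈ Y   = mids-share-short-cycle X Y

  -- Short cycles stay inside one gadget

  adjacent-≢ : ∀ {u v} → .(T (adj G u v)) → u ≢ v
  adjacent-≢ {u} uv refl = subst T (irrefl G u) (recompute (T? (adj G u u)) uv)

  isMid : YV G → Bool
  isMid (mV _ _ _ _) = true
  isMid _            = false

  -- The v of a port a(u,v) or b(u,v); a junk value on M(u).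
  direction : YV G → V
  direction (aV _ v _)   = v
  direction (bV _ v _)   = v
  direction (mV u _ _ _) = u

  Tw-sym : ∀ tw {u v} → Tw G tw u v → Tw G tw v u
  Tw-sym (just _) (inj₁ (u≡ , v≡)) = inj₂ (v≡ , u≡)
  Tw-sym (just _) (inj₂ (u≡ , v≡)) = inj₁ (v≡ , u≡)

  module _ {tw : TwistChoice G} where

    YE-sym : ∀ {x y} → YE G tw x y → YE G tw y x
    YE-sym (am v∈S) = ma v∈S
    YE-sym (ma v∈S) = am v∈S
    YE-sym (bm v∉S) = mb v∉S
    YE-sym (mb v∉S) = bm v∉S
    YE-sym (aa ¬tw) = aa (¬tw ∘ Tw-sym tw)
    YE-sym (bb ¬tw) = bb (¬tw ∘ Tw-sym tw)
    YE-sym (ab tw)  = ba (Tw-sym _ tw)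
    YE-sym (ba tw)  = ab (Tw-sym _ tw)

    neighbour-of-mid-is-port : ∀ {x y} → isMid x ≡ true → YE G tw x y → isMid y ≡ false
    neighbour-of-mid-is-port _ (ma _) = refl
    neighbour-of-mid-is-port _ (mb _) = refl

    mid-edge-in-gadget : ∀ {x y} → isMid x ≡ true → YE G tw x y → gadget G x ≡ gadget G y
    mid-edge-in-gadget _ (ma _) = refl
    mid-edge-in-gadget _ (mb _) = refl

    interior-edge-in-gadget : ∀ {x y} → YE G tw x y → isMid x ≡ true ⊎ isMid y ≡ true →
      gadget G x ≡ gadget G y
    interior-edge-in-gadget xy (inj₁ x-mid) = mid-edge-in-gadget x-mid xy
    interior-edge-in-gadget xy (inj₂ y-mid) = sym (mid-edge-in-gadget y-mid (YE-sym xy))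

    gadget-across-mid : ∀ {x y z} → YE G tw x y → YE G tw y z → isMid y ≡ true → gadget G x ≡ gadget G z
    gadget-across-mid xy yz y-mid = trans (interior-edge-in-gadget xy (inj₂ y-mid)) (mid-edge-in-gadget y-mid yz)

    cross-edge-direction : ∀ {x y} → YE G tw x y → isMid x ≡ false → isMid y ≡ false →
      direction x ≡ gadget G y
    cross-edge-direction (aa _) _ _ = refl
    cross-edge-direction (bb _) _ _ = refl
    cross-edge-direction (ab _) _ _ = refl
    cross-edge-direction (ba _) _ _ = refl

    cross-edge-gadgets-differ : ∀ {x y} → YE G tw x y → isMid x ≡ false → isMid y ≡ false →
      gadget G x ≢ gadget G y
    cross-edge-gadgets-differ (aa {p = uv} _) _ _ = adjacent-≢ uv
    cross-edge-gadgets-differ (bb {p = uv} _) _ _ = adjacent-≢ uv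
    cross-edge-gadgets-differ (ab {p = uv} _) _ _ = adjacent-≢ uv
    cross-edge-gadgets-differ (ba {p = uv} _) _ _ = adjacent-≢ uv

    port-has-one-port-neighbour : ∀ {x y z} → YE G tw x y → YE G tw x z →
      isMid x ≡ false → isMid y ≡ false → isMid z ≡ false → y ≡ z
    port-has-one-port-neighbour (aa _)   (aa _)   _ _ _ = refl
    port-has-one-port-neighbour (aa ¬tw) (ab tw)  _ _ _ = contradiction tw ¬tw
    port-has-one-port-neighbour (ab tw)  (aa ¬tw) _ _ _ = contradiction tw ¬tw
    port-has-one-port-neighbour (ab _)   (ab _)   _ _ _ = refl
    port-has-one-port-neighbour (bb _)   (bb _)   _ _ _ = refl
    port-has-one-port-neighbour (bb ¬tw) (ba tw)  _ _ _ = contradiction tw ¬tw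
    port-has-one-port-neighbour (ba tw)  (bb ¬tw) _ _ _ = contradiction tw ¬tw
    port-has-one-port-neighbour (ba _)   (ba _)   _ _ _ = refl

    second-neighbour-is-mid : ∀ {x y z} → YE G tw x y → YE G tw x z →
      isMid x ≡ false → isMid y ≡ false → y ≢ z → isMid z ≡ true
    second-neighbour-is-mid {z = z} xy xz x-port y-port y≢z with isMid z in z-mid
    ... | true  = refl
    ... | false = contradiction (port-has-one-port-neighbour xy xz x-port y-port z-mid) y≢z

    -- The twist swaps the outside partners of a(u,v) and b(u,v) but keeps them distinct.
    twins-have-no-common-neighbour : ∀ {x x′ z} → isMid x ≡ false → isMid x′ ≡ false →
      gadget G x ≡ gadget G x′ → direction x ≡ direction x′ → x ≢ x′ → YE G tw x z → ¬ YE G tw x′ z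
    twins-have-no-common-neighbour {aV u v _} {aV .u .v _} _ _ refl refl x≢x′ _ _ = x≢x′ refl
    twins-have-no-common-neighbour {bV u v _} {bV .u .v _} _ _ refl refl x≢x′ _ _ = x≢x′ refl
    twins-have-no-common-neighbour {aV u v _} {bV .u .v _} _ _ refl refl _ (am v∈S) (bm v∉S) = v∉S v∈S
    twins-have-no-common-neighbour {aV u v _} {bV .u .v _} _ _ refl refl _ (aa ¬tw) (ba tw)  = ¬tw tw
    twins-have-no-common-neighbour {aV u v _} {bV .u .v _} _ _ refl refl _ (ab tw)  (bb ¬tw) = ¬tw tw
    twins-have-no-common-neighbour {bV u v _} {aV .u .v _} _ _ refl refl _ (bm v∉S) (am v∈S) = v∉S v∈S
    twins-have-no-common-neighbour {bV u v _} {aV .u .v _} _ _ refl refl _ (ba tw)  (aa ¬tw) = ¬tw tw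
    twins-have-no-common-neighbour {bV u v _} {aV .u .v _} _ _ refl refl _ (bb ¬tw) (ab tw)  = ¬tw tw

    port-has-one-mid-neighbour : ∀ {x y z} → deg G (gadget G x) ≤ 2 → YE G tw x y → YE G tw x z →
      isMid y ≡ true → isMid z ≡ true → y ≡ z
    port-has-one-mid-neighbour small (am {S = S} {q = q} {r} v∈S) (am {S = S′} {q = q′} {r′} v∈S′) _ _ =
      mV-cong (trans (even-⊆-small-∈ (recompute-⊆ q) small (recompute-even {S} r) v∈S)
                     (sym (even-⊆-small-∈ (recompute-⊆ q′) small (recompute-even {S′} r′) v∈S′)))
    port-has-one-mid-neighbour small (bm {S = S} {p = uv} {q} {r} v∉S) (bm {S = S′} {q = q′} {r′} v∉S′) _ _ =
      mV-cong (trans (even-⊆-small-∉ (recompute-⊆ q) small (recompute-even {S} r) (adj⇒∈N uv) v∉S)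
                     (sym (even-⊆-small-∉ (recompute-⊆ q′) small (recompute-even {S′} r′) (adj⇒∈N uv) v∉S′)))

    record Loop (L : ℕ) : Set where
      field
        g         : ℕ → YV G
        edge      : ∀ k → YE G tw (g k) (g (suc k))
        periodic  : g L ≡ g 0
        injective : ∀ {a b} → a < L → b < L → g a ≡ g b → a ≡ b

    Loop-closing : ∀ {m} (loop : Loop (suc m)) → YE G tw (Loop.g loop m) (Loop.g loop 0)
    Loop-closing {m} loop = subst (YE G tw (g m)) periodic (edge m)
      where open Loop loop

    module CrossEdgeAtStart {m} (loop : Loop (suc m)) (2≤m : 2 ≤ m)
      (port₀ : isMid (Loop.g loop 0) ≡ false) (port₁ : isMid (Loop.g loop 1) ≡ false) where

      open Loop loop public

      back : ∀ k → YE G tw (g (suc k)) (g k)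
      back k = YE-sym (edge k)

      closing : YE G tw (g m) (g 0)
      closing = Loop-closing loop

      distinct : ∀ a b {a<L : True (a <? suc m)} {b<L : True (b <? suc m)} {a≢b : False (a ≟ b)} → g a ≢ g b
      distinct a b {a<L} {b<L} {a≢b} ga≡gb =
        toWitnessFalse a≢b (injective (toWitness a<L) (toWitness b<L) ga≡gb)

      mid₂ : isMid (g 2) ≡ true
      mid₂ = second-neighbour-is-mid (back 0) (edge 1) port₁ port₀
        (λ g₀≡g₂ → contradiction (injective z<s (s≤s 2≤m) g₀≡g₂) λ ())

      mid-last : isMid (g m) ≡ true
      mid-last = second-neighbour-is-mid (edge 0) (YE-sym closing) port₀ port₁
        (λ g₁≡gₘ → <⇒≢ 2≤m (injective (m<n⇒m<1+n 2≤m) ≤-refl g₁≡gₘ))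

    -- After the cross edge g₀g₁ the positions 2 and m hold M-vertices. For m ≤ 7 what remains is too
    -- short: it has two adjacent M-vertices or three consecutive ports, or it returns from g₁ to g₀
    -- inside one gadget, or it contains twins a(w,v), b(w,v) with a common neighbour.
    short-loop-has-no-cross-edge : ∀ {m} → 2 ≤ m → m < 8 → (loop : Loop (suc m)) →
      isMid (Loop.g loop 0) ≡ false → isMid (Loop.g loop 1) ≡ false → ⊥ₑ
    short-loop-has-no-cross-edge {2} 2≤m _ loop port₀ port₁ =
      cross-edge-gadgets-differ (edge 0) port₀ port₁ (sym (gadget-across-mid (edge 1) closing mid₂))
      where open CrossEdgeAtStart loop 2≤m port₀ port₁
    short-loop-has-no-cross-edge {3} 2≤m _ loop port₀ port₁ =
      true≢false (trans (sym mid-last) (neighbour-of-mid-is-port mid₂ (edge 2)))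
      where open CrossEdgeAtStart loop 2≤m port₀ port₁
    short-loop-has-no-cross-edge {4} 2≤m _ loop port₀ port₁ =
      cross-edge-gadgets-differ (edge 0) port₀ port₁
        (sym (trans (gadget-across-mid (edge 1) (edge 2) mid₂) (gadget-across-mid (edge 3) closing mid-last)))
      where open CrossEdgeAtStart loop 2≤m port₀ port₁
    short-loop-has-no-cross-edge {5} 2≤m _ loop port₀ port₁ =
      twins-have-no-common-neighbour port₁ port₃ (gadget-across-mid (edge 1) (edge 2) mid₂) same-direction
        (distinct 1 3) (edge 1) (back 2)
      where
      open CrossEdgeAtStart loop 2≤m port₀ port₁
      port₃ = neighbour-of-mid-is-port mid₂ (edge 2)
      port₄ = neighbour-of-mid-is-port mid-last (back 4)
      same-direction : direction (g 1) ≡ direction (g 3)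
      same-direction = begin
        direction (g 1) ≡⟨ cross-edge-direction (back 0) port₁ port₀ ⟩
        gadget G (g 0)  ≡⟨ gadget-across-mid (edge 4) closing mid-last ⟨
        gadget G (g 4)  ≡⟨ cross-edge-direction (edge 3) port₃ port₄ ⟨
        direction (g 3) ∎
        where open ≡-Reasoning
    short-loop-has-no-cross-edge {6} 2≤m _ loop port₀ port₁ with isMid (Loop.g loop 4) in g₄-kind
    ... | true = cross-edge-gadgets-differ (edge 0) port₀ port₁ (sym (begin
        gadget G (g 1) ≡⟨ gadget-across-mid (edge 1) (edge 2) mid₂ ⟩
        gadget G (g 3) ≡⟨ gadget-across-mid (edge 3) (edge 4) g₄-kind ⟩
        gadget G (g 5) ≡⟨ gadget-across-mid (edge 5) closing mid-last ⟩
        gadget G (g 0) ∎))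
      where
      open CrossEdgeAtStart loop 2≤m port₀ port₁
      open ≡-Reasoning
    ... | false = true≢false (trans (sym mid₅) port₅)
      where
      open CrossEdgeAtStart loop 2≤m port₀ port₁
      port₃ = neighbour-of-mid-is-port mid₂ (edge 2)
      port₅ = neighbour-of-mid-is-port mid-last (back 5)
      mid₅ = second-neighbour-is-mid (back 3) (edge 4) g₄-kind port₃ (distinct 3 5)
    short-loop-has-no-cross-edge {7} 2≤m _ loop port₀ port₁ with isMid (Loop.g loop 4) in g₄-kind
    ... | true =
      twins-have-no-common-neighbour port₀ port₆ (sym (gadget-across-mid (edge 6) closing mid-last))
        same-direction (distinct 0 6) (YE-sym closing) (edge 6)
      where
      open CrossEdgeAtStart loop 2≤m port₀ port₁
      port₃ = neighbour-of-mid-is-port mid₂ (edge 2)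
      port₅ = neighbour-of-mid-is-port g₄-kind (edge 4)
      port₆ = neighbour-of-mid-is-port mid-last (back 6)
      same-direction : direction (g 0) ≡ direction (g 6)
      same-direction = begin
        direction (g 0) ≡⟨ cross-edge-direction (edge 0) port₀ port₁ ⟩
        gadget G (g 1)  ≡⟨ gadget-across-mid (edge 1) (edge 2) mid₂ ⟩
        gadget G (g 3)  ≡⟨ gadget-across-mid (edge 3) (edge 4) g₄-kind ⟩
        gadget G (g 5)  ≡⟨ cross-edge-direction (back 5) port₆ port₅ ⟨
        direction (g 6) ∎
        where open ≡-Reasoning
    ... | false =
      twins-have-no-common-neighbour port₁ port₃ (gadget-across-mid (edge 1) (edge 2) mid₂) same-direction
        (distinct 1 3) (edge 1) (back 2)
      where
      open CrossEdgeAtStart loop 2≤m port₀ port₁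
      port₃ = neighbour-of-mid-is-port mid₂ (edge 2)
      mid₅ = second-neighbour-is-mid (back 3) (edge 4) g₄-kind port₃ (distinct 3 5)
      same-direction : direction (g 1) ≡ direction (g 3)
      same-direction = begin
        direction (g 1) ≡⟨ cross-edge-direction (back 0) port₁ port₀ ⟩
        gadget G (g 0)  ≡⟨ gadget-across-mid (edge 6) closing mid-last ⟨
        gadget G (g 6)  ≡⟨ gadget-across-mid (edge 4) (edge 5) mid₅ ⟨
        gadget G (g 4)  ≡⟨ cross-edge-direction (edge 3) port₃ g₄-kind ⟨
        direction (g 3) ∎
        where open ≡-Reasoning
    short-loop-has-no-cross-edge {1} (s≤s ()) _ _ _ _
    short-loop-has-no-cross-edge {suc (suc (suc (suc (suc (suc (suc (suc _)))))))} _
      (s≤s (s≤s (s≤s (s≤s (s≤s (s≤s (s≤s (s≤s ())))))))) _ _ _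

    module Walk (C : Cycle G tw) where

      open Cycle C

      index : ℕ → Fin (suc m)
      index k = fromℕ< (m%n<n k (suc m))

      walk : ℕ → YV G
      walk k = c (index k)

      toℕ-index : ∀ k → toℕ (index k) ≡ k % suc m
      toℕ-index k = toℕ-fromℕ< (m%n<n k (suc m))

      walk-toℕ : ∀ i → walk (toℕ i) ≡ c i
      walk-toℕ i = cong c (toℕ-injective (trans (toℕ-index (toℕ i)) (m<n⇒m%n≡m (toℕ<n i))))

      walk-cong : ∀ a b → a % suc m ≡ b % suc m → walk a ≡ walk b
      walk-cong a b eq = cong c (toℕ-injective (trans (toℕ-index a) (trans eq (sym (toℕ-index b)))))

      walk-injective : ∀ a b → walk a ≡ walk b → a % suc m ≡ b % suc m
      walk-injective a b eq = trans (sym (toℕ-index a)) (trans (cong toℕ (inj eq)) (toℕ-index b))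

      edge-to : ∀ (i j : Fin (suc m)) → toℕ j ≡ suc (toℕ i) % suc m → YE G tw (c i) (c j)
      edge-to i j j≡ with view i
      ... | ‵fromℕ = subst (YE G tw (c (fromℕ m)) ∘ c) (toℕ-injective (sym (begin
        toℕ j                   ≡⟨ j≡ ⟩
        suc (toℕ (fromℕ m)) % suc m ≡⟨ cong (λ t → suc t % suc m) (toℕ-fromℕ m) ⟩
        suc m % suc m           ≡⟨ n%n≡0 (suc m) ⟩
        0                       ∎))) close
        where open ≡-Reasoning
      ... | ‵inject₁ i′ = subst (YE G tw (c (inject₁ i′)) ∘ c) (toℕ-injective (sym (begin
        toℕ j                         ≡⟨ j≡ ⟩
        suc (toℕ (inject₁ i′)) % suc m ≡⟨ cong (λ t → suc t % suc m) (toℕ-inject₁ i′) ⟩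
        suc (toℕ i′) % suc m          ≡⟨ m<n⇒m%n≡m (s≤s (toℕ<n i′)) ⟩
        suc (toℕ i′)                  ∎))) (edges i′)
        where open ≡-Reasoning

      walk-edge : ∀ k → YE G tw (walk k) (walk (suc k))
      walk-edge k = edge-to (index k) (index (suc k)) (begin
        toℕ (index (suc k))          ≡⟨ toℕ-index (suc k) ⟩
        suc k % suc m                ≡⟨ suc-% (suc m) k ⟩
        suc (k % suc m) % suc m      ≡⟨ cong (λ t → suc t % suc m) (toℕ-index k) ⟨
        suc (toℕ (index k)) % suc m  ∎)
        where open ≡-Reasoning

      rotation : ℕ → Loop (suc m)
      rotation j = record
        { g         = λ k → walk (k + j)
        ; edge      = λ k → walk-edge (k + j)
        ; periodic  = walk-cong (suc m + j) j
                        (trans (cong (_% suc m) (+-comm (suc m) j)) ([m+n]%n≡m%n j (suc m)))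
        ; injective = λ {a} {b} a<L b<L eq → trans (sym (m<n⇒m%n≡m a<L))
                        (trans (+-cancelʳ-% (suc m) a b j (walk-injective (a + j) (b + j) eq))
                               (m<n⇒m%n≡m b<L))
        }

      module _ (short : length G C ≤ 8) where

        edges-are-interior : ∀ k → isMid (walk k) ≡ true ⊎ isMid (walk (suc k)) ≡ true
        edges-are-interior k with isMid (walk k) in kindₖ | isMid (walk (suc k)) in kindₖ₊₁
        ... | true  | _     = inj₁ refl
        ... | false | true  = inj₂ refl
        ... | false | false = ⊥-elim (short-loop-has-no-cross-edge len≥3 short (rotation k) kindₖ kindₖ₊₁)

        walk-in-one-gadget : ∀ k → gadget G (walk k) ≡ gadget G (c zero)
        walk-in-one-gadget zero    = refl
        walk-in-one-gadget (suc k) =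
          trans (sym (interior-edge-in-gadget (walk-edge k) (edges-are-interior k))) (walk-in-one-gadget k)

        on-cycle-in-gadget : ∀ {x} → OnCycle G x C → gadget G x ≡ gadget G (c zero)
        on-cycle-in-gadget (i , cᵢ≡x) =
          trans (cong (gadget G) (trans (sym cᵢ≡x) (sym (walk-toℕ i)))) (walk-in-one-gadget (toℕ i))

        ∃-port-on-cycle : ∃ λ j → isMid (walk j) ≡ false
        ∃-port-on-cycle with isMid (walk 0) in kind₀
        ... | false = 0 , kind₀
        ... | true  = 1 , neighbour-of-mid-is-port kind₀ (walk-edge 0)

        -- A port on the cycle has two distinct cycle neighbours, both in M(u) as the cycle has no cross edge.
        gadget-degree≥3 : 3 ≤ deg G (gadget G (c zero))
        gadget-degree≥3 with 3 ≤? deg G (gadget G (c zero))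
        ... | yes 3≤deg = 3≤deg
        ... | no  3≰deg = ⊥-elim (<⇒≢ len≥3 (injective (m<n⇒m<1+n len≥3) ≤-refl g₁≡gₘ))
          where
          j = proj₁ ∃-port-on-cycle
          port₀ = proj₂ ∃-port-on-cycle
          open Loop (rotation j)
          small : deg G (gadget G (g 0)) ≤ 2
          small = subst (λ v → deg G v ≤ 2) (sym (walk-in-one-gadget j)) (≤-pred (≰⇒> 3≰deg))
          mid₁ : isMid (g 1) ≡ true
          mid₁ with edges-are-interior j
          ... | inj₁ mid₀ = contradiction (trans (sym mid₀) port₀) true≢false
          ... | inj₂ mid₁ = mid₁
          midₘ : isMid (g m) ≡ true
          midₘ with edges-are-interior (m + j)
          ... | inj₁ midₘ = midₘ
          ... | inj₂ mid₀ = contradiction (trans (sym mid₀) (trans (cong isMid periodic) port₀)) true≢false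
          g₁≡gₘ : g 1 ≡ g m
          g₁≡gₘ = port-has-one-mid-neighbour small (edge 0) (YE-sym (Loop-closing (rotation j))) mid₁ midₘ

lemma7p12 : (G : Graph) → 2 ≤ n G → Connected G →
    (tw : TwistChoice G) (x : YV G) →
      ((∃ λ u → 3 ≤ deg G u × gadget G x ≡ u) ⇔ OnShortCycle G tw x)
      × (∀ u → 3 ≤ deg G u → gadget G x ≡ u →
           ∀ (y : YV G) → (gadget G y ≡ u ⇔ CommonShortCycle G tw x y))
lemma7p12 G _ _ tw x = mk⇔ on-short-cycle in-gadget-of-degree≥3 , gadget⇔common-short-cycle
  where
  on-short-cycle : (∃ λ u → 3 ≤ deg G u × gadget G x ≡ u) → OnShortCycle G tw x
  on-short-cycle (u , 3≤deg , x∈Yu) =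
    let C , short , on-x , _ = gadget-vertices-share-short-cycle G tw 3≤deg x x x∈Yu x∈Yu
    in  C , short , on-x

  in-gadget-of-degree≥3 : OnShortCycle G tw x → ∃ λ u → 3 ≤ deg G u × gadget G x ≡ u
  in-gadget-of-degree≥3 (C , short , on-x) = _ , gadget-degree≥3 C short , on-cycle-in-gadget C short on-x
    where open Walk G

  gadget⇔common-short-cycle : ∀ u → 3 ≤ deg G u → gadget G x ≡ u →
    ∀ y → (gadget G y ≡ u ⇔ CommonShortCycle G tw x y)
  gadget⇔common-short-cycle u 3≤deg x∈Yu y = mk⇔
    (gadget-vertices-share-short-cycle G tw 3≤deg x y x∈Yu)
    (λ (C , short , on-x , on-y) →
      trans (on-cycle-in-gadget C short on-y) (trans (sym (on-cycle-in-gadget C short on-x)) x∈Yu))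
    where open Walk G
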